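{- The set of Sprugnoli arrays of the form $(1,f_1,f_2)$ (with $f_1\in\mathcal{F}_1$ and $f_2\in\mathcal{F}_1$ odd) is a subgroup of the Sprugnoli group.
   Context: All power series are formal power series over a field $\mathbb{K}$ of characteristic $0$. $\mathcal{F}_r$ denotes the set of power series $\sum_{n\ge r}a_nx^n$ with $a_r\ne0$. A Sprugnoli array is a triple $(g,f_1,f_2)$ with $g\in\mathcal{F}_0$, $f_1\in\mathcal{F}_1$, $f_2\in\mathcal{F}_1$ and $f_2$ odd (only odd powers of $x$); its matrix is the lower-triangular matrix $(t_{n,k})$ with $t_{n,k}=[x^n]\,g(x)f_1(x)^{k\bmod 2}(xf_2(x))^{\lfloor k/2\rfloor}$. For $h=\sum_n a_nx^n$, $(g,f_1,f_2)\cdot h=\sum_n(\sum_k t_{n,k}a_k)x^n$. The Sprugnoli group is the set of Sprugnoli arrays with the product $S\cdot(u,v_1,v_2)=\left(S\cdot u,\frac{S\cdot(uv_1)}{S\cdot u},\frac1x\frac{S\cdot(xuv_2)}{S\cdot u}\right)$ for $S=(g,f_1,f_2)$, and identity $(1,x,x)$; this product corresponds to multiplication of the associated matrices. -}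

module Defs where

open import Level using (_⊔_)
open import Data.Nat as ℕ using (ℕ; zero; suc; _∸_)
open import Data.Nat.DivMod using (_%_; _/_)
open import Data.Product using (_×_; _,_)
open import Relation.Nullary using (¬_)
open import Algebra.Bundles using (CommutativeRing)

-- A field: a commutative ring with 0 ≠ 1 in which every nonzero element
-- has a multiplicative inverse (the inverse function is total; its value
-- at 0 is irrelevant).
record Field (c ℓ : Level.Level) : Set (Level.suc (c ⊔ ℓ)) where
  field
    commutativeRing : CommutativeRing c ℓ
  open CommutativeRing commutativeRing public
  field
    _⁻¹     : Carrier → Carrier
    0≉1     : ¬ (0# ≈ 1#)
    inverseʳ : ∀ x → ¬ (x ≈ 0#) → (x * (x ⁻¹)) ≈ 1#

module Sprugnoli {c ℓ} (F : Field c ℓ) where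
  open Field F

  natK : ℕ → Carrier
  natK zero    = 0#
  natK (suc n) = 1# + natK n

  Char0 : Set ℓ
  Char0 = ∀ n → ¬ (natK (suc n) ≈ 0#)

  PS : Set c
  PS = ℕ → Carrier

  sumTo : ℕ → (ℕ → Carrier) → Carrier
  sumTo zero    f = f 0
  sumTo (suc n) f = sumTo n f + f (suc n)

  _≋_ : PS → PS → Set ℓ
  a ≋ b = ∀ n → a n ≈ b n

  zeroPS : PS
  zeroPS _ = 0#

  onePS : PS
  onePS zero    = 1#
  onePS (suc _) = 0#

  xPS : PS
  xPS zero          = 0#
  xPS (suc zero)    = 1#
  xPS (suc (suc _)) = 0#

  _⋆_ : PS → PS → PS
  (a ⋆ b) n = sumTo n (λ i → a i * b (n ∸ i))

  _^ₚ_ : PS → ℕ → PS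
  a ^ₚ zero  = onePS
  a ^ₚ suc k = a ⋆ (a ^ₚ k)

  -- multiplicative inverse of a series with nonzero constant term b₀:
  -- b = b₀ (1 - e) with e₀ = 0, and b⁻¹ = b₀⁻¹ Σ_j e^j
  -- (the sum is finite coefficientwise since e^j has order ≥ j)
  invPS : PS → PS
  invPS b n = (b 0 ⁻¹) * sumTo n (λ j → (e ^ₚ j) n)
    where
    e : PS
    e zero    = 0#
    e (suc m) = - ((b 0 ⁻¹) * b (suc m))

  divPS : PS → PS → PS
  divPS a b = a ⋆ invPS b

  -- (1/x) a  (used only when a has zero constant term)
  shiftPS : PS → PS
  shiftPS a n = a (suc n)

  record Triple : Set c where
    constructor ⟨_,_,_⟩
    field
      g f₁ f₂ : PS

  open Triple public

  -- (g , f₁ , f₂) is a Sprugnoli array: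
  -- g ∈ 𝓕₀, f₁ ∈ 𝓕₁, f₂ ∈ 𝓕₁ and f₂ odd
  IsSprugnoli : Triple → Set ℓ
  IsSprugnoli S =
    ¬ (g S 0 ≈ 0#) ×
    (f₁ S 0 ≈ 0#) × ¬ (f₁ S 1 ≈ 0#) ×
    (f₂ S 0 ≈ 0#) × ¬ (f₂ S 1 ≈ 0#) ×
    (∀ m → f₂ S (2 ℕ.* m) ≈ 0#)

  entry : Triple → ℕ → ℕ → Carrier
  entry S n k = ((g S ⋆ (f₁ S ^ₚ (k % 2))) ⋆ ((xPS ⋆ f₂ S) ^ₚ (k / 2))) n

  -- S · h = Σ_n (Σ_k t_{n,k} a_k) x^n   (t is lower triangular, so k ≤ n)
  act : Triple → PS → PS
  act S h n = sumTo n (λ k → entry S n k * h k)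

  _⊙_ : Triple → Triple → Triple
  S ⊙ ⟨ u , v₁ , v₂ ⟩ =
    ⟨ act S u
    , divPS (act S (u ⋆ v₁)) (act S u)
    , shiftPS (divPS (act S ((xPS ⋆ u) ⋆ v₂)) (act S u)) ⟩

  idS : Triple
  idS = ⟨ onePS , xPS , xPS ⟩

  _≈S_ : Triple → Triple → Set ℓ
  S ≈S T = (g S ≋ g T) × (f₁ S ≋ f₁ T) × (f₂ S ≋ f₂ T)

  InH : Triple → Set ℓ
  InH S = IsSprugnoli S × (g S ≋ onePS)

  IsSubgroupH : Set (c ⊔ ℓ)
  IsSubgroupH =
    InH idS ×
    (∀ S T → InH S → InH T → InH (S ⊙ T)) ×
    (∀ S → InH S → Data.Product.Σ Triple (λ T →
        InH T × ((S ⊙ T) ≈S idS) × ((T ⊙ S) ≈S idS)))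

-- An array S = (1, f₁, f₂) has a lower-triangular matrix whose columns are
-- 1, f₁, y, f₁y, y², f₁y², … with y = x f₂, an even series of order 2 since f₂ is odd;
-- its diagonal entries are products of f₁'s and f₂'s leading coefficients, hence nonzero.
-- Thus S acts on series as the substitution E(x²) + x O(x²) ↦ E(y) + f₁ O(y), which is
-- multiplicative on even series. For T = (1, u₁, u₂) the product is
-- S ⊙ T = (1, S·u₁, (1/x) S·(x u₂)), and S·_ preserves order and evenness, so H is closed.
-- For the inverse, solve the triangular systems S·v₁ = x and S·w = x² and put
-- T = (1, v₁, w/x); then S ⊙ T = id. By multiplicativity S maps the columns wʲ, v₁wʲ of T
-- to the monomials x²ʲ, x²ʲ⁺¹, so S·(T·h) = h, and injectivity of S·_ turns this into
-- T·(S·h) = h, which is T ⊙ S = id.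

module Submission where

open import Level using (Level)
open import Defs
open import Data.Nat as ℕ using (ℕ; zero; suc; _∸_; _≤_; _<_; z≤n; s≤s; parity)
import Data.Nat.Properties as ℕP
open import Data.Nat.Induction using (<-rec)
open import Data.Nat.DivMod using (_/_; m/n≡1+[m∸n]/n)
import Data.Parity.Base as ℙ
open ℙ using (0ℙ; 1ℙ)
import Data.Parity.Properties as ℙP
open import Data.Product using (Σ; _×_; _,_; proj₁; proj₂)
open import Data.Sum using (_⊎_; inj₁; inj₂; [_,_]′)
open import Data.Unit using (⊤; tt)
open import Data.Empty using (⊥-elim)
open import Function using (_∘_)
open import Relation.Nullary using (¬_; yes; no)
open import Relation.Binary.PropositionalEquality as ≡ using (_≡_; _≢_)

n≤m⇒m<n+o⇒m∸n<o : ∀ {m n o} → n ≤ m → m < n ℕ.+ o → m ∸ n < o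
n≤m⇒m<n+o⇒m∸n<o {m} {n} {o} n≤m m<n+o = ≡.subst (m ∸ n <_) (ℕP.m+n∸m≡n n o) (ℕP.∸-monoˡ-< m<n+o n≤m)

Odd : ℕ → Set
Odd n = parity n ≡ 1ℙ

parity-∸ : ∀ {i n} → i ≤ n → parity n ≡ parity i ℙ.+ parity (n ∸ i)
parity-∸ {i} {n} i≤n = ≡.trans (≡.cong parity (≡.sym (ℕP.m+[n∸m]≡n i≤n))) (ℙP.+-homo-+ i (n ∸ i))

Odd-suc-2* : ∀ m → Odd (suc (2 ℕ.* m))
Odd-suc-2* m = ≡.trans (ℙP.+-homo-+ 1 (2 ℕ.* m)) (≡.cong ℙ._⁻¹ (ℙP.*-homo-* 2 m))

Odd-suc⇒2* : ∀ {n} → Odd (suc n) → Σ ℕ (λ m → n ≡ 2 ℕ.* m)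
Odd-suc⇒2* {zero}        _     = 0 , ≡.refl
Odd-suc⇒2* {suc zero}    ()
Odd-suc⇒2* {suc (suc n)} odd with Odd-suc⇒2* {n} odd
... | m , ≡.refl = suc m , ≡.sym (ℕP.*-suc 2 m)

module SubgroupH {c ℓ : Level} (F : Field c ℓ) where
  open Field F hiding (zero)
  open Sprugnoli F
  open import Relation.Binary.Reasoning.Setoid setoid
  open import Algebra.Properties.Ring ring using (x[y-z]≈xy-xz)
  open import Algebra.Properties.AbelianGroup +-abelianGroup
    using (x∙y⁻¹≈ε⇒x≈y; x≈y⇒x∙y⁻¹≈ε; ⁻¹-∙-comm; ε⁻¹≈ε; xyx⁻¹≈y)
  open import Algebra.Properties.CommutativeSemigroup +-commutativeSemigroup using (interchange)
  open import Algebra.Properties.CommutativeSemigroup *-commutativeSemigroup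
    using (x∙yz≈y∙xz; xy∙z≈y∙xz)

  1≉0 : ¬ (1# ≈ 0#)
  1≉0 1≈0 = 0≉1 (sym 1≈0)

  x≈0⇒x*y≈0 : ∀ {x y} → x ≈ 0# → x * y ≈ 0#
  x≈0⇒x*y≈0 {y = y} x≈0 = trans (*-cong x≈0 refl) (zeroˡ y)

  y≈0⇒x*y≈0 : ∀ {x y} → y ≈ 0# → x * y ≈ 0#
  y≈0⇒x*y≈0 {x} y≈0 = trans (*-cong refl y≈0) (zeroʳ x)

  x*y≈0⇒y≈0 : ∀ {x y} → ¬ (x ≈ 0#) → x * y ≈ 0# → y ≈ 0#
  x*y≈0⇒y≈0 {x} {y} x≉0 xy≈0 = begin
    y                ≈⟨ sym (*-identityˡ y) ⟩
    1# * y           ≈⟨ *-cong (sym (inverseʳ x x≉0)) refl ⟩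
    (x * x ⁻¹) * y   ≈⟨ xy∙z≈y∙xz x (x ⁻¹) y ⟩
    x ⁻¹ * (x * y)   ≈⟨ y≈0⇒x*y≈0 xy≈0 ⟩
    0#               ∎

  *-≉0 : ∀ {x y} → ¬ (x ≈ 0#) → ¬ (y ≈ 0#) → ¬ (x * y ≈ 0#)
  *-≉0 x≉0 y≉0 xy≈0 = y≉0 (x*y≈0⇒y≈0 x≉0 xy≈0)

  x*[y*x⁻¹]≈y : ∀ {x} y → ¬ (x ≈ 0#) → x * (y * x ⁻¹) ≈ y
  x*[y*x⁻¹]≈y {x} y x≉0 = begin
    x * (y * x ⁻¹)  ≈⟨ x∙yz≈y∙xz x y (x ⁻¹) ⟩
    y * (x * x ⁻¹)  ≈⟨ *-cong refl (inverseʳ x x≉0) ⟩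
    y * 1#          ≈⟨ *-identityʳ y ⟩
    y               ∎

  x≈1⇒x⁻¹≈1 : ∀ {x} → x ≈ 1# → x ⁻¹ ≈ 1#
  x≈1⇒x⁻¹≈1 {x} x≈1 = begin
    x ⁻¹       ≈⟨ sym (*-identityˡ (x ⁻¹)) ⟩
    1# * x ⁻¹  ≈⟨ *-cong (sym x≈1) refl ⟩
    x * x ⁻¹   ≈⟨ inverseʳ x (λ x≈0 → 1≉0 (trans (sym x≈1) x≈0)) ⟩
    1#         ∎

  -- Finite sums

  sumTo-cong-≤ : ∀ n {f h : ℕ → Carrier} → (∀ {i} → i ≤ n → f i ≈ h i) → sumTo n f ≈ sumTo n h
  sumTo-cong-≤ zero    f≈h = f≈h z≤n
  sumTo-cong-≤ (suc n) f≈h =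
    +-cong (sumTo-cong-≤ n (λ i≤n → f≈h (ℕP.m≤n⇒m≤1+n i≤n))) (f≈h ℕP.≤-refl)

  sumTo-cong : ∀ n {f h : ℕ → Carrier} → (∀ i → f i ≈ h i) → sumTo n f ≈ sumTo n h
  sumTo-cong n f≈h = sumTo-cong-≤ n (λ {i} _ → f≈h i)

  sumTo-zero : ∀ n {f : ℕ → Carrier} → (∀ {i} → i ≤ n → f i ≈ 0#) → sumTo n f ≈ 0#
  sumTo-zero zero    f≈0 = f≈0 z≤n
  sumTo-zero (suc n) f≈0 =
    trans (+-cong (sumTo-zero n (λ i≤n → f≈0 (ℕP.m≤n⇒m≤1+n i≤n))) (f≈0 ℕP.≤-refl)) (+-identityʳ 0#)

  sumTo-+ : ∀ n (f h : ℕ → Carrier) → sumTo n (λ i → f i + h i) ≈ sumTo n f + sumTo n h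
  sumTo-+ zero    f h = refl
  sumTo-+ (suc n) f h = trans (+-cong (sumTo-+ n f h) refl) (interchange _ _ _ _)

  sumTo-*ˡ : ∀ n x (f : ℕ → Carrier) → x * sumTo n f ≈ sumTo n (λ i → x * f i)
  sumTo-*ˡ zero    x f = refl
  sumTo-*ˡ (suc n) x f = trans (distribˡ x _ _) (+-cong (sumTo-*ˡ n x f) refl)

  sumTo-*ʳ : ∀ n x (f : ℕ → Carrier) → sumTo n f * x ≈ sumTo n (λ i → f i * x)
  sumTo-*ʳ n x f = trans (*-comm _ x) (trans (sumTo-*ˡ n x f) (sumTo-cong n (λ i → *-comm x (f i))))

  sumTo-neg : ∀ n (f : ℕ → Carrier) → - sumTo n f ≈ sumTo n (λ i → - f i)
  sumTo-neg zero    f = refl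
  sumTo-neg (suc n) f = trans (sym (⁻¹-∙-comm _ _)) (+-cong (sumTo-neg n f) refl)

  sumTo-sucˡ : ∀ n (f : ℕ → Carrier) → sumTo (suc n) f ≈ f 0 + sumTo n (λ i → f (suc i))
  sumTo-sucˡ zero    f = refl
  sumTo-sucˡ (suc n) f = trans (+-cong (sumTo-sucˡ n f) refl) (+-assoc _ _ _)

  sumTo-swap : ∀ m n (f : ℕ → ℕ → Carrier) →
               sumTo m (λ i → sumTo n (λ j → f i j)) ≈ sumTo n (λ j → sumTo m (λ i → f i j))
  sumTo-swap zero    n f = refl
  sumTo-swap (suc m) n f =
    trans (+-cong (sumTo-swap m n f) refl) (sym (sumTo-+ n (λ j → sumTo m (λ i → f i j)) (f (suc m))))

  sumTo-extend : ∀ {m} n {f : ℕ → Carrier} → m ≤ n → (∀ {i} → m < i → f i ≈ 0#) →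
                 sumTo n f ≈ sumTo m f
  sumTo-extend zero    z≤n    _   = refl
  sumTo-extend (suc n) m≤1+n f≈0 with ℕP.m≤n⇒m<n∨m≡n m≤1+n
  ... | inj₁ m<1+n  =
    trans (+-cong (sumTo-extend n (ℕP.m<1+n⇒m≤n m<1+n) f≈0) (f≈0 m<1+n)) (+-identityʳ _)
  ... | inj₂ ≡.refl = refl

  sumTo-single : ∀ n {j} {f : ℕ → Carrier} → j ≤ n → (∀ {i} → i ≤ n → i ≢ j → f i ≈ 0#) →
                 sumTo n f ≈ f j
  sumTo-single zero    z≤n _ = refl
  sumTo-single (suc n) {j} j≤1+n others with j ℕ.≟ suc n
  ... | yes ≡.refl =
    trans (+-cong (sumTo-zero n (λ i≤n → others (ℕP.m≤n⇒m≤1+n i≤n) (ℕP.<⇒≢ (s≤s i≤n)))) refl)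
          (+-identityˡ _)
  ... | no j≢1+n   =
    trans (+-cong (sumTo-single n (ℕP.m<1+n⇒m≤n (ℕP.≤∧≢⇒< j≤1+n j≢1+n)) (λ i≤n → others (ℕP.m≤n⇒m≤1+n i≤n)))
                  (others ℕP.≤-refl (j≢1+n ∘ ≡.sym)))
          (+-identityʳ _)

  -- Formal power series

  infixl 6 _+ₚ_
  infixl 7 _·ₚ_

  _+ₚ_ : PS → PS → PS
  (a +ₚ b) n = a n + b n

  _·ₚ_ : Carrier → PS → PS
  (x ·ₚ a) n = x * a n

  _-ₚ_ : PS → PS → PS
  (a -ₚ b) n = a n - b n

  shift² : PS → PS
  shift² a = shiftPS (shiftPS a)

  ≋-sym : ∀ {a b} → a ≋ b → b ≋ a
  ≋-sym a≋b n = sym (a≋b n)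

  ≋-trans : ∀ {a b d} → a ≋ b → b ≋ d → a ≋ d
  ≋-trans a≋b b≋d n = trans (a≋b n) (b≋d n)

  ⋆-cong : ∀ {a a′ b b′} → a ≋ a′ → b ≋ b′ → (a ⋆ b) ≋ (a′ ⋆ b′)
  ⋆-cong a≋a′ b≋b′ n = sumTo-cong n (λ i → *-cong (a≋a′ i) (b≋b′ (n ∸ i)))

  ⋆-congˡ : ∀ {a a′} b → a ≋ a′ → (a ⋆ b) ≋ (a′ ⋆ b)
  ⋆-congˡ b a≋a′ = ⋆-cong {b = b} a≋a′ (λ _ → refl)

  ⋆-congʳ : ∀ a {b b′} → b ≋ b′ → (a ⋆ b) ≋ (a ⋆ b′)
  ⋆-congʳ a = ⋆-cong {a} (λ _ → refl)

  ⋆-sucˡ : ∀ a b n → (a ⋆ b) (suc n) ≈ a 0 * b (suc n) + (shiftPS a ⋆ b) n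
  ⋆-sucˡ a b n = sumTo-sucˡ n (λ i → a i * b (suc n ∸ i))

  ⋆-sucʳ : ∀ a b n → (a ⋆ b) (suc n) ≈ (a ⋆ shiftPS b) n + a (suc n) * b 0
  ⋆-sucʳ a b n =
    +-cong (sumTo-cong-≤ n (λ i≤n → *-cong refl (reflexive (≡.cong b (ℕP.+-∸-assoc 1 i≤n)))))
           (*-cong refl (reflexive (≡.cong b (ℕP.n∸n≡0 n))))

  ⋆-comm : ∀ a b → (a ⋆ b) ≋ (b ⋆ a)
  ⋆-comm a b zero    = *-comm (a 0) (b 0)
  ⋆-comm a b (suc n) = begin
    (a ⋆ b) (suc n)                          ≈⟨ ⋆-sucˡ a b n ⟩
    a 0 * b (suc n) + (shiftPS a ⋆ b) n      ≈⟨ +-cong (*-comm _ _) (⋆-comm (shiftPS a) b n) ⟩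
    b (suc n) * a 0 + (b ⋆ shiftPS a) n      ≈⟨ +-comm _ _ ⟩
    (b ⋆ shiftPS a) n + b (suc n) * a 0      ≈⟨ ⋆-sucʳ b a n ⟨
    (b ⋆ a) (suc n)                          ∎

  ⋆-distribʳ : ∀ a b d → ((a +ₚ b) ⋆ d) ≋ (a ⋆ d +ₚ b ⋆ d)
  ⋆-distribʳ a b d n = trans (sumTo-cong n (λ i → distribʳ (d (n ∸ i)) (a i) (b i))) (sumTo-+ n _ _)

  ⋆-distribˡ : ∀ a b d → (a ⋆ (b +ₚ d)) ≋ (a ⋆ b +ₚ a ⋆ d)
  ⋆-distribˡ a b d n =
    trans (⋆-comm a (b +ₚ d) n) (trans (⋆-distribʳ b d a n) (+-cong (⋆-comm b a n) (⋆-comm d a n)))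

  ⋆-·ₚˡ : ∀ x a b → ((x ·ₚ a) ⋆ b) ≋ (x ·ₚ (a ⋆ b))
  ⋆-·ₚˡ x a b n = trans (sumTo-cong n (λ i → *-assoc x (a i) (b (n ∸ i)))) (sym (sumTo-*ˡ n x _))

  ⋆-·ₚʳ : ∀ x a b → (a ⋆ (x ·ₚ b)) ≋ (x ·ₚ (a ⋆ b))
  ⋆-·ₚʳ x a b n = trans (⋆-comm a (x ·ₚ b) n) (trans (⋆-·ₚˡ x b a n) (*-cong refl (⋆-comm b a n)))

  ⋆-assoc : ∀ a b d → ((a ⋆ b) ⋆ d) ≋ (a ⋆ (b ⋆ d))
  ⋆-assoc a b d zero    = *-assoc _ _ _
  ⋆-assoc a b d (suc n) = begin
    ((a ⋆ b) ⋆ d) (suc n)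
      ≈⟨ ⋆-sucˡ (a ⋆ b) d n ⟩
    (a 0 * b 0) * d (suc n) + (shiftPS (a ⋆ b) ⋆ d) n
      ≈⟨ +-cong (*-assoc _ _ _) (⋆-congˡ d (⋆-sucˡ a b) n) ⟩
    a 0 * (b 0 * d (suc n)) + ((a 0 ·ₚ shiftPS b +ₚ shiftPS a ⋆ b) ⋆ d) n
      ≈⟨ +-cong refl (⋆-distribʳ _ _ d n) ⟩
    a 0 * (b 0 * d (suc n)) + (((a 0 ·ₚ shiftPS b) ⋆ d) n + ((shiftPS a ⋆ b) ⋆ d) n)
      ≈⟨ +-cong refl (+-cong (⋆-·ₚˡ (a 0) (shiftPS b) d n) (⋆-assoc (shiftPS a) b d n)) ⟩
    a 0 * (b 0 * d (suc n)) + (a 0 * (shiftPS b ⋆ d) n + (shiftPS a ⋆ (b ⋆ d)) n)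
      ≈⟨ +-assoc _ _ _ ⟨
    (a 0 * (b 0 * d (suc n)) + a 0 * (shiftPS b ⋆ d) n) + (shiftPS a ⋆ (b ⋆ d)) n
      ≈⟨ +-cong (trans (*-cong refl (⋆-sucˡ b d n)) (distribˡ (a 0) _ _)) refl ⟨
    a 0 * (b ⋆ d) (suc n) + (shiftPS a ⋆ (b ⋆ d)) n
      ≈⟨ ⋆-sucˡ a (b ⋆ d) n ⟨
    (a ⋆ (b ⋆ d)) (suc n) ∎

  ⋆-identityˡ : ∀ a → (onePS ⋆ a) ≋ a
  ⋆-identityˡ a n = trans (sumTo-single n z≤n others) (*-identityˡ (a n))
    where
    others : ∀ {i} → i ≤ n → i ≢ 0 → onePS i * a (n ∸ i) ≈ 0#
    others {zero}  _ 0≢0 = ⊥-elim (0≢0 ≡.refl)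
    others {suc i} _ _   = zeroˡ _

  ⋆-identityʳ : ∀ a → (a ⋆ onePS) ≋ a
  ⋆-identityʳ a = ≋-trans (⋆-comm a onePS) (⋆-identityˡ a)

  ^ₚ-+ : ∀ a i j → (a ^ₚ (i ℕ.+ j)) ≋ ((a ^ₚ i) ⋆ (a ^ₚ j))
  ^ₚ-+ a zero    j = ≋-sym (⋆-identityˡ (a ^ₚ j))
  ^ₚ-+ a (suc i) j = ≋-trans (⋆-congʳ a (^ₚ-+ a i j)) (≋-sym (⋆-assoc a (a ^ₚ i) (a ^ₚ j)))

  x⋆-zero : ∀ a → (xPS ⋆ a) 0 ≈ 0#
  x⋆-zero a = zeroˡ (a 0)

  x⋆-suc : ∀ a n → (xPS ⋆ a) (suc n) ≈ a n
  x⋆-suc a n = trans (sumTo-single (suc n) (s≤s z≤n) others) (*-identityˡ (a n))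
    where
    others : ∀ {i} → i ≤ suc n → i ≢ 1 → xPS i * a (suc n ∸ i) ≈ 0#
    others {zero}        _ _   = zeroˡ _
    others {suc zero}    _ 1≢1 = ⊥-elim (1≢1 ≡.refl)
    others {suc (suc i)} _ _   = zeroˡ _

  x⋆-shiftPS : ∀ a → a 0 ≈ 0# → (xPS ⋆ shiftPS a) ≋ a
  x⋆-shiftPS a a₀≈0 zero    = trans (x⋆-zero (shiftPS a)) (sym a₀≈0)
  x⋆-shiftPS a a₀≈0 (suc n) = x⋆-suc (shiftPS a) n

  x^ₚ1≋x : (xPS ^ₚ 1) ≋ xPS
  x^ₚ1≋x = ⋆-identityʳ xPS

  x^ₚ-diagonal : ∀ k → (xPS ^ₚ k) k ≈ 1#
  x^ₚ-diagonal zero    = refl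
  x^ₚ-diagonal (suc k) = trans (x⋆-suc (xPS ^ₚ k) k) (x^ₚ-diagonal k)

  x^ₚ-offDiagonal : ∀ {k n} → n ≢ k → (xPS ^ₚ k) n ≈ 0#
  x^ₚ-offDiagonal {zero}  {zero}  0≢0 = ⊥-elim (0≢0 ≡.refl)
  x^ₚ-offDiagonal {zero}  {suc n} _   = refl
  x^ₚ-offDiagonal {suc k} {zero}  _   = x⋆-zero (xPS ^ₚ k)
  x^ₚ-offDiagonal {suc k} {suc n} n≢k =
    trans (x⋆-suc (xPS ^ₚ k) n) (x^ₚ-offDiagonal (λ n≡k → n≢k (≡.cong suc n≡k)))

  x^ₚ-diagonal≉0 : ∀ k → ¬ ((xPS ^ₚ k) k ≈ 0#)
  x^ₚ-diagonal≉0 k xᵏₖ≈0 = 1≉0 (trans (sym (x^ₚ-diagonal k)) xᵏₖ≈0)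

  shiftPS-x^ₚ2 : shiftPS (xPS ^ₚ 2) ≋ xPS
  shiftPS-x^ₚ2 n = trans (x⋆-suc (xPS ^ₚ 1) n) (x^ₚ1≋x n)

  ⋆-local : ∀ a b b′ n → a 0 ≈ 0# → (∀ {m} → m < n → b m ≈ b′ m) → (a ⋆ b) n ≈ (a ⋆ b′) n
  ⋆-local a b b′ zero    a₀≈0 _    = trans (x≈0⇒x*y≈0 a₀≈0) (sym (x≈0⇒x*y≈0 a₀≈0))
  ⋆-local a b b′ (suc n) a₀≈0 b≈b′ = begin
    (a ⋆ b) (suc n)                         ≈⟨ ⋆-sucˡ a b n ⟩
    a 0 * b (suc n) + (shiftPS a ⋆ b) n
      ≈⟨ +-cong (trans (x≈0⇒x*y≈0 a₀≈0) (sym (x≈0⇒x*y≈0 a₀≈0)))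
                (sumTo-cong-≤ n (λ {i} _ → *-cong refl (b≈b′ (s≤s (ℕP.m∸n≤m n i))))) ⟩
    a 0 * b′ (suc n) + (shiftPS a ⋆ b′) n   ≈⟨ ⋆-sucˡ a b′ n ⟨
    (a ⋆ b′) (suc n)                        ∎

  shift²-⋆ : ∀ a b → a 1 ≈ 0# → shift² (a ⋆ b) ≋ (a 0 ·ₚ shift² b +ₚ shift² a ⋆ b)
  shift²-⋆ a b a₁≈0 n = begin
    (a ⋆ b) (suc (suc n))                                   ≈⟨ ⋆-sucˡ a b (suc n) ⟩
    a 0 * b (suc (suc n)) + (shiftPS a ⋆ b) (suc n)         ≈⟨ +-cong refl (⋆-sucˡ (shiftPS a) b n) ⟩
    a 0 * b (suc (suc n)) + (a 1 * b (suc n) + (shift² a ⋆ b) n)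
      ≈⟨ +-cong refl (trans (+-cong (x≈0⇒x*y≈0 a₁≈0) refl) (+-identityˡ _)) ⟩
    a 0 * b (suc (suc n)) + (shift² a ⋆ b) n                ∎

  ⋆-coeff₁ : ∀ a b → a 1 ≈ 0# → (a ⋆ b) 1 ≈ a 0 * b 1
  ⋆-coeff₁ a b a₁≈0 = trans (+-cong refl (x≈0⇒x*y≈0 a₁≈0)) (+-identityʳ _)

  -- Order and parity of series

  VanishesOn : (ℕ → Set) → PS → Set ℓ
  VanishesOn Z a = ∀ n → Z n → a n ≈ 0#

  OrderAtLeast : ℕ → PS → Set ℓ
  OrderAtLeast j = VanishesOn (_< j)

  Even : PS → Set ℓ
  Even = VanishesOn Odd

  VanishesOn-≋ : ∀ {Z a b} → a ≋ b → VanishesOn Z a → VanishesOn Z b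
  VanishesOn-≋ a≋b a≈0 n Zn = trans (sym (a≋b n)) (a≈0 n Zn)

  OrderAtLeast-⋆ : ∀ {i j a b} → OrderAtLeast i a → OrderAtLeast j b →
                   OrderAtLeast (i ℕ.+ j) (a ⋆ b)
  OrderAtLeast-⋆ {i} {j} {a} {b} a≈0 b≈0 n n<i+j = sumTo-zero n term
    where
    term : ∀ {k} → k ≤ n → a k * b (n ∸ k) ≈ 0#
    term {k} k≤n with k ℕP.<? i
    ... | yes k<i = x≈0⇒x*y≈0 (a≈0 k k<i)
    ... | no  k≮i =
      y≈0⇒x*y≈0 (b≈0 (n ∸ k) (n≤m⇒m<n+o⇒m∸n<o k≤n (ℕP.<-≤-trans n<i+j (ℕP.+-monoˡ-≤ j (ℕP.≮⇒≥ k≮i)))))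

  ⋆-leading : ∀ {i j a b} → OrderAtLeast i a → OrderAtLeast j b → (a ⋆ b) (i ℕ.+ j) ≈ a i * b j
  ⋆-leading {i} {j} {a} {b} a≈0 b≈0 =
    trans (sumTo-single (i ℕ.+ j) (ℕP.m≤m+n i j) term)
          (*-cong refl (reflexive (≡.cong b (ℕP.m+n∸m≡n i j))))
    where
    term : ∀ {k} → k ≤ i ℕ.+ j → k ≢ i → a k * b (i ℕ.+ j ∸ k) ≈ 0#
    term {k} k≤i+j k≢i with k ℕP.<? i
    ... | yes k<i = x≈0⇒x*y≈0 (a≈0 k k<i)
    ... | no  k≮i =
      y≈0⇒x*y≈0 (b≈0 (i ℕ.+ j ∸ k) (n≤m⇒m<n+o⇒m∸n<o k≤i+j (ℕP.+-monoˡ-< j (ℕP.≤∧≢⇒< (ℕP.≮⇒≥ k≮i) (k≢i ∘ ≡.sym)))))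

  Even-⋆ : ∀ {a b} → Even a → Even b → Even (a ⋆ b)
  Even-⋆ {a} {b} a-even b-even n n-odd = sumTo-zero n term
    where
    term : ∀ {i} → i ≤ n → a i * b (n ∸ i) ≈ 0#
    term {i} i≤n with parity i in pᵢ
    ... | 1ℙ = x≈0⇒x*y≈0 (a-even i pᵢ)
    ... | 0ℙ = y≈0⇒x*y≈0 (b-even (n ∸ i) (≡.trans (≡.sym n-i-parity) n-odd))
      where
      n-i-parity : parity n ≡ parity (n ∸ i)
      n-i-parity = ≡.trans (parity-∸ i≤n) (≡.cong (ℙ._+ parity (n ∸ i)) pᵢ)

  onePS-even : Even onePS
  onePS-even zero    ()
  onePS-even (suc n) _ = refl

  x^ₚ-order : ∀ k → OrderAtLeast k (xPS ^ₚ k)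
  x^ₚ-order k n n<k = x^ₚ-offDiagonal (ℕP.<⇒≢ n<k)

  x^ₚ2-even : Even (xPS ^ₚ 2)
  x^ₚ2-even n n-odd = x^ₚ-offDiagonal {n = n} (n≢2 n-odd)
    where
    n≢2 : ∀ {n} → Odd n → n ≢ 2
    n≢2 () ≡.refl

  -- Lower-triangular matrices acting on series

  Matrix : Set c
  Matrix = ℕ → ℕ → Carrier

  apply : Matrix → PS → PS
  apply t h n = sumTo n (λ k → t n k * h k)

  column : Matrix → ℕ → PS
  column t k n = t n k

  LowerTriangular : Matrix → Set ℓ
  LowerTriangular t = ∀ k → OrderAtLeast k (column t k)

  NonzeroDiagonal : Matrix → Set ℓ
  NonzeroDiagonal t = ∀ n → ¬ (t n n ≈ 0#)

  apply-cong : ∀ t {h h′} → h ≋ h′ → apply t h ≋ apply t h′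
  apply-cong t h≋h′ n = sumTo-cong n (λ k → *-cong refl (h≋h′ k))

  apply-+ₚ : ∀ t a b → apply t (a +ₚ b) ≋ (apply t a +ₚ apply t b)
  apply-+ₚ t a b n = trans (sumTo-cong n (λ k → distribˡ (t n k) (a k) (b k))) (sumTo-+ n _ _)

  apply-·ₚ : ∀ t x a → apply t (x ·ₚ a) ≋ (x ·ₚ apply t a)
  apply-·ₚ t x a n = trans (sumTo-cong n (λ k → x∙yz≈y∙xz (t n k) x (a k))) (sym (sumTo-*ˡ n x _))

  apply--ₚ : ∀ t a b → apply t (a -ₚ b) ≋ (apply t a -ₚ apply t b)
  apply--ₚ t a b n = begin
    sumTo n (λ k → t n k * (a k - b k))            ≈⟨ sumTo-cong n (λ k → x[y-z]≈xy-xz (t n k) (a k) (b k)) ⟩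
    sumTo n (λ k → t n k * a k - t n k * b k)      ≈⟨ sumTo-+ n _ _ ⟩
    apply t a n + sumTo n (λ k → - (t n k * b k))  ≈⟨ +-cong refl (sumTo-neg n _) ⟨
    apply t a n - apply t b n                      ∎

  apply-extend : ∀ {t} → LowerTriangular t → ∀ h {n N} → n ≤ N →
                 apply t h n ≈ sumTo N (λ k → t n k * h k)
  apply-extend t-lower h n≤N = sym (sumTo-extend _ n≤N (λ {k} n<k → x≈0⇒x*y≈0 (t-lower k _ n<k)))

  apply-apply : ∀ s {t} → LowerTriangular t → ∀ h n →
                apply s (apply t h) n ≈ sumTo n (λ k → apply s (column t k) n * h k)
  apply-apply s {t} t-lower h n = begin
    sumTo n (λ m → s n m * apply t h m)
      ≈⟨ sumTo-cong-≤ n (λ m≤n → *-cong refl (apply-extend t-lower h m≤n)) ⟩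
    sumTo n (λ m → s n m * sumTo n (λ k → t m k * h k))
      ≈⟨ sumTo-cong n (λ m → sumTo-*ˡ n (s n m) _) ⟩
    sumTo n (λ m → sumTo n (λ k → s n m * (t m k * h k)))
      ≈⟨ sumTo-swap n n _ ⟩
    sumTo n (λ k → sumTo n (λ m → s n m * (t m k * h k)))
      ≈⟨ sumTo-cong n (λ k → sumTo-cong n (λ m → *-assoc _ _ _)) ⟨
    sumTo n (λ k → sumTo n (λ m → (s n m * t m k) * h k))
      ≈⟨ sumTo-cong n (λ k → sumTo-*ʳ n (h k) _) ⟨
    sumTo n (λ k → apply s (column t k) n * h k)
      ∎

  apply-x^ₚ : ∀ {t} → LowerTriangular t → ∀ k → apply t (xPS ^ₚ k) ≋ column t k
  apply-x^ₚ {t} t-lower k n with k ℕ.≤? n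
  ... | yes k≤n = trans (sumTo-single n k≤n (λ {i} _ i≢k → y≈0⇒x*y≈0 (x^ₚ-offDiagonal {k} {i} i≢k)))
                        (trans (*-cong refl (x^ₚ-diagonal k)) (*-identityʳ _))
  ... | no  k≰n = trans (sumTo-zero n (λ {i} i≤n → y≈0⇒x*y≈0 (x^ₚ-offDiagonal {k} {i} (k≰n ∘ ≤-k i≤n))))
                        (sym (t-lower k n (ℕP.≰⇒> k≰n)))
    where
    ≤-k : ∀ {i} → i ≤ n → i ≡ k → k ≤ n
    ≤-k i≤n ≡.refl = i≤n

  apply-inverseˡ : ∀ s {t} → LowerTriangular t → (∀ k → apply s (column t k) ≋ (xPS ^ₚ k)) →
                   ∀ h → apply s (apply t h) ≋ h
  apply-inverseˡ s {t} t-lower s-inverts h n = begin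
    apply s (apply t h) n
      ≈⟨ apply-apply s t-lower h n ⟩
    sumTo n (λ k → apply s (column t k) n * h k)
      ≈⟨ sumTo-cong n (λ k → *-cong (s-inverts k n) refl) ⟩
    sumTo n (λ k → (xPS ^ₚ k) n * h k)
      ≈⟨ sumTo-single n ℕP.≤-refl (λ _ k≢n → x≈0⇒x*y≈0 (x^ₚ-offDiagonal (k≢n ∘ ≡.sym))) ⟩
    (xPS ^ₚ n) n * h n
      ≈⟨ trans (*-cong (x^ₚ-diagonal n) refl) (*-identityˡ (h n)) ⟩
    h n ∎

  apply-diagonal : ∀ t h n → (∀ {k} → k < n → t n k * h k ≈ 0#) → apply t h n ≈ t n n * h n
  apply-diagonal t h n below≈0 = sumTo-single n ℕP.≤-refl (λ k≤n k≢n → below≈0 (ℕP.≤∧≢⇒< k≤n k≢n))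

  apply-leading : ∀ t {j h} → OrderAtLeast j h → apply t h j ≈ t j j * h j
  apply-leading t {j} {h} h≈0 = apply-diagonal t h j (λ {k} k<j → y≈0⇒x*y≈0 (h≈0 k k<j))

  _PreservesVanishingOn_ : Matrix → (ℕ → Set) → Set ℓ
  t PreservesVanishingOn Z = ∀ {n k} → Z n → k < n → Z k ⊎ t n k ≈ 0#

  PreservesVanishingOn-< : ∀ t j → t PreservesVanishingOn (_< j)
  PreservesVanishingOn-< t j n<j k<n = inj₁ (ℕP.<-trans k<n n<j)

  apply-vanishesOn : ∀ {t Z h} → t PreservesVanishingOn Z → VanishesOn Z h → VanishesOn Z (apply t h)
  apply-vanishesOn {t} {Z} {h} t-preserves h≈0 n Zn = sumTo-zero n term
    where
    term : ∀ {k} → k ≤ n → t n k * h k ≈ 0#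
    term {k} k≤n with ℕP.m≤n⇒m<n∨m≡n k≤n
    ... | inj₁ k<n    = [ (λ Zk → y≈0⇒x*y≈0 (h≈0 k Zk)) , x≈0⇒x*y≈0 ]′ (t-preserves Zn k<n)
    ... | inj₂ ≡.refl = y≈0⇒x*y≈0 (h≈0 n Zn)

  apply-vanishesOn⁻¹ : ∀ {t Z h} → NonzeroDiagonal t → t PreservesVanishingOn Z →
                       VanishesOn Z (apply t h) → VanishesOn Z h
  apply-vanishesOn⁻¹ {t} {Z} {h} t-diagonal t-preserves th≈0 n = <-rec (λ n → Z n → h n ≈ 0#) step n
    where
    step : ∀ n → (∀ {m} → m < n → Z m → h m ≈ 0#) → Z n → h n ≈ 0#
    step n ih Zn = x*y≈0⇒y≈0 (t-diagonal n) (trans (sym (apply-diagonal t h n below≈0)) (th≈0 n Zn))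
      where
      below≈0 : ∀ {k} → k < n → t n k * h k ≈ 0#
      below≈0 k<n = [ (λ Zk → y≈0⇒x*y≈0 (ih k<n Zk)) , x≈0⇒x*y≈0 ]′ (t-preserves Zn k<n)

  apply-injective : ∀ {t} → NonzeroDiagonal t → ∀ {a b} → apply t a ≋ apply t b → a ≋ b
  apply-injective {t} t-diagonal {a} {b} ta≋tb n =
    x∙y⁻¹≈ε⇒x≈y (a n) (b n) (apply-vanishesOn⁻¹ t-diagonal (λ _ _ → inj₁ tt) t[a-b]≈0 n tt)
    where
    t[a-b]≈0 : VanishesOn (λ _ → ⊤) (apply t (a -ₚ b))
    t[a-b]≈0 m _ = trans (apply--ₚ t a b m) (x≈y⇒x∙y⁻¹≈ε (ta≋tb m))

  module TriangularSolution (t : Matrix) (t-diagonal : NonzeroDiagonal t) (b : PS) where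
    next : ℕ → PS → Carrier
    next n h = (b (suc n) - sumTo n (λ j → t (suc n) j * h j)) * t (suc n) (suc n) ⁻¹

    -- approx n is the solution on the indices 0, …, n (and junk beyond)
    approx : ℕ → PS
    approx zero    _ = b 0 * t 0 0 ⁻¹
    approx (suc n) k with k ℕ.≤? n
    ... | yes _ = approx n k
    ... | no  _ = next n (approx n)

    solution : PS
    solution k = approx k k

    approx-top : ∀ n → approx (suc n) (suc n) ≡ next n (approx n)
    approx-top n with suc n ℕ.≤? n
    ... | yes 1+n≤n = ⊥-elim (ℕP.<-irrefl ≡.refl 1+n≤n)
    ... | no  _     = ≡.refl

    approx-suc : ∀ {k n} → k ≤ n → approx (suc n) k ≡ approx n k
    approx-suc {k} {n} k≤n with k ℕ.≤? n
    ... | yes _   = ≡.refl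
    ... | no  k≰n = ⊥-elim (k≰n k≤n)

    approx-stable : ∀ {k n} → k ≤ n → approx n k ≡ solution k
    approx-stable {n = zero}  z≤n    = ≡.refl
    approx-stable {n = suc n} k≤1+n with ℕP.m≤n⇒m<n∨m≡n k≤1+n
    ... | inj₁ (s≤s k≤n) = ≡.trans (approx-suc k≤n) (approx-stable k≤n)
    ... | inj₂ ≡.refl    = ≡.refl

    solves : apply t solution ≋ b
    solves zero    = x*[y*x⁻¹]≈y (b 0) (t-diagonal 0)
    solves (suc n) = begin
      sumTo n (λ j → t (suc n) j * solution j) + t (suc n) (suc n) * solution (suc n)
        ≈⟨ +-cong (sumTo-cong-≤ n (λ j≤n → *-cong refl (reflexive (≡.sym (approx-stable j≤n)))))
                  (*-cong refl (reflexive (approx-top n))) ⟩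
      r + t (suc n) (suc n) * ((b (suc n) - r) * t (suc n) (suc n) ⁻¹)
        ≈⟨ +-cong refl (x*[y*x⁻¹]≈y _ (t-diagonal (suc n))) ⟩
      r + (b (suc n) - r)
        ≈⟨ +-assoc r (b (suc n)) (- r) ⟨
      r + b (suc n) - r
        ≈⟨ xyx⁻¹≈y r (b (suc n)) ⟩
      b (suc n) ∎
      where
      r : Carrier
      r = sumTo n (λ j → t (suc n) j * approx n j)

  apply-surjective : ∀ {t} → NonzeroDiagonal t → ∀ b → Σ PS (λ h → apply t h ≋ b)
  apply-surjective {t} t-diagonal b = solution , solves
    where open TriangularSolution t t-diagonal b

  toeplitz : PS → Matrix
  toeplitz a n k = a (n ∸ k)

  ⋆-as-apply : ∀ a b → (a ⋆ b) ≋ apply (toeplitz a) b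
  ⋆-as-apply a b n = trans (⋆-comm a b n) (sumTo-cong n (λ k → *-comm (b k) (a (n ∸ k))))

  ⋆-apply : ∀ a {t} → LowerTriangular t → ∀ h n →
            (a ⋆ apply t h) n ≈ sumTo n (λ k → (a ⋆ column t k) n * h k)
  ⋆-apply a {t} t-lower h n = begin
    (a ⋆ apply t h) n
      ≈⟨ ⋆-as-apply a (apply t h) n ⟩
    apply (toeplitz a) (apply t h) n
      ≈⟨ apply-apply (toeplitz a) t-lower h n ⟩
    sumTo n (λ k → apply (toeplitz a) (column t k) n * h k)
      ≈⟨ sumTo-cong n (λ k → *-cong (⋆-as-apply a (column t k) n) refl) ⟨
    sumTo n (λ k → (a ⋆ column t k) n * h k) ∎

  -- The action of an array (1, f₁, f₂)

  module Action (S : Triple) (S∈H : InH S) where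
    g≋1 : g S ≋ onePS
    g≋1 = proj₂ S∈H

    f₁₀≈0 : f₁ S 0 ≈ 0#
    f₁₀≈0 = let ((_ , f₁₀≈0 , _) , _) = S∈H in f₁₀≈0

    f₁₁≉0 : ¬ (f₁ S 1 ≈ 0#)
    f₁₁≉0 = let ((_ , _ , f₁₁≉0 , _) , _) = S∈H in f₁₁≉0

    f₂₀≈0 : f₂ S 0 ≈ 0#
    f₂₀≈0 = let ((_ , _ , _ , f₂₀≈0 , _) , _) = S∈H in f₂₀≈0

    f₂₁≉0 : ¬ (f₂ S 1 ≈ 0#)
    f₂₁≉0 = let ((_ , _ , _ , _ , f₂₁≉0 , _) , _) = S∈H in f₂₁≉0

    f₂-odd : ∀ m → f₂ S (2 ℕ.* m) ≈ 0#
    f₂-odd = let ((_ , _ , _ , _ , _ , f₂-odd) , _) = S∈H in f₂-odd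

    y : PS
    y = xPS ⋆ f₂ S

    col : ℕ → PS
    col = column (entry S)

    y-order : OrderAtLeast 2 y
    y-order zero          _ = x⋆-zero (f₂ S)
    y-order (suc zero)    _ = trans (x⋆-suc (f₂ S) 0) f₂₀≈0
    y-order (suc (suc _)) (s≤s (s≤s ()))

    y-even : Even y
    y-even zero    ()
    y-even (suc n) odd with Odd-suc⇒2* {n} odd
    ... | m , ≡.refl = trans (x⋆-suc (f₂ S) (2 ℕ.* m)) (f₂-odd m)

    col-0 : col 0 ≋ onePS
    col-0 = ≋-trans (⋆-identityʳ _) (≋-trans (⋆-identityʳ (g S)) g≋1)

    col-1 : col 1 ≋ f₁ S
    col-1 = ≋-trans (⋆-identityʳ _) (≋-trans (⋆-cong g≋1 (⋆-identityʳ (f₁ S))) (⋆-identityˡ (f₁ S)))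

    col-suc-suc : ∀ k → col (suc (suc k)) ≋ (y ⋆ col k)
    col-suc-suc k n =
      -- (k + 2) % 2 computes to k % 2, whereas (k + 2) / 2 only provably equals suc (k / 2)
      trans (reflexive (≡.cong (λ j → (G ⋆ (y ^ₚ j)) n) (m/n≡1+[m∸n]/n {suc (suc k)} {2} (s≤s (s≤s z≤n)))))
            (trans (sym (⋆-assoc G y (y ^ₚ (k / 2)) n))
                   (trans (⋆-congˡ (y ^ₚ (k / 2)) (⋆-comm G y) n) (⋆-assoc y G (y ^ₚ (k / 2)) n)))
      where
      G : PS
      G = g S ⋆ (f₁ S ^ₚ (k ℕ.% 2))

    entry-lowerTriangular : LowerTriangular (entry S)
    entry-lowerTriangular zero          = λ _ ()
    entry-lowerTriangular (suc zero)    = VanishesOn-≋ (≋-sym col-1) λ { zero _ → f₁₀≈0 ; (suc _) (s≤s ()) }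
    entry-lowerTriangular (suc (suc k)) =
      VanishesOn-≋ (≋-sym (col-suc-suc k)) (OrderAtLeast-⋆ y-order (entry-lowerTriangular k))

    entry-nonzeroDiagonal : NonzeroDiagonal (entry S)
    entry-nonzeroDiagonal zero          c≈0 = 1≉0 (trans (sym (col-0 0)) c≈0)
    entry-nonzeroDiagonal (suc zero)    c≈0 = f₁₁≉0 (trans (sym (col-1 1)) c≈0)
    entry-nonzeroDiagonal (suc (suc k)) c≈0 = *-≉0 f₂₁≉0 (entry-nonzeroDiagonal k) (trans (sym diagonal) c≈0)
      where
      diagonal : col (suc (suc k)) (suc (suc k)) ≈ f₂ S 1 * col k k
      diagonal = trans (col-suc-suc k (2 ℕ.+ k))
                       (trans (⋆-leading y-order (entry-lowerTriangular k)) (*-cong (x⋆-suc (f₂ S) 1) refl))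

    col-even : ∀ k → parity k ≡ 0ℙ → Even (col k)
    col-even zero          _    = VanishesOn-≋ (≋-sym col-0) onePS-even
    col-even (suc zero)    ()
    col-even (suc (suc k)) even = VanishesOn-≋ (≋-sym (col-suc-suc k)) (Even-⋆ y-even (col-even k even))

    entry-preservesEven : entry S PreservesVanishingOn Odd
    entry-preservesEven {n} {k} n-odd _ with parity k in pₖ
    ... | 1ℙ = inj₁ ≡.refl
    ... | 0ℙ = inj₂ (col-even k pₖ n n-odd)

    act-x^ₚ : ∀ k → act S (xPS ^ₚ k) ≋ col k
    act-x^ₚ = apply-x^ₚ entry-lowerTriangular

    act-one : act S onePS ≋ onePS
    act-one = ≋-trans (act-x^ₚ 0) col-0

    act-leading≉0 : ∀ {j h} → OrderAtLeast j h → ¬ (h j ≈ 0#) → ¬ (act S h j ≈ 0#)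
    act-leading≉0 {j} h-order hⱼ≉0 Shⱼ≈0 =
      *-≉0 (entry-nonzeroDiagonal j) hⱼ≉0 (trans (sym (apply-leading (entry S) h-order)) Shⱼ≈0)

    act-leading≉0⁻¹ : ∀ {j h} → OrderAtLeast j h → ¬ (act S h j ≈ 0#) → ¬ (h j ≈ 0#)
    act-leading≉0⁻¹ h-order Shⱼ≉0 hⱼ≈0 = Shⱼ≉0 (trans (apply-leading (entry S) h-order) (y≈0⇒x*y≈0 hⱼ≈0))

    act-unfold : ∀ h → act S h ≋ (h 0 ·ₚ onePS +ₚ (h 1 ·ₚ f₁ S +ₚ y ⋆ act S (shift² h)))
    act-unfold h n = begin
      act S h n
        ≈⟨ apply-extend entry-lowerTriangular h (ℕP.m≤n+m n 2) ⟩
      sumTo (suc (suc n)) (λ k → col k n * h k)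
        ≈⟨ trans (sumTo-sucˡ (suc n) _) (+-cong refl (sumTo-sucˡ n _)) ⟩
      col 0 n * h 0 + (col 1 n * h 1 + sumTo n (λ k → col (suc (suc k)) n * shift² h k))
        ≈⟨ +-cong (trans (*-comm _ _) (*-cong refl (col-0 n)))
                  (+-cong (trans (*-comm _ _) (*-cong refl (col-1 n)))
                          (sumTo-cong n (λ k → *-cong (col-suc-suc k n) refl))) ⟩
      h 0 * onePS n + (h 1 * f₁ S n + sumTo n (λ k → (y ⋆ col k) n * shift² h k))
        ≈⟨ +-cong refl (+-cong refl (⋆-apply y entry-lowerTriangular (shift² h) n)) ⟨
      h 0 * onePS n + (h 1 * f₁ S n + (y ⋆ act S (shift² h)) n)
        ∎

    act-unfold-even : ∀ E → E 1 ≈ 0# → act S E ≋ (E 0 ·ₚ onePS +ₚ y ⋆ act S (shift² E))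
    act-unfold-even E E₁≈0 n =
      trans (act-unfold E n) (+-cong refl (trans (+-cong (x≈0⇒x*y≈0 E₁≈0) refl) (+-identityˡ _)))

    act-⋆-unfold : ∀ E h → E 1 ≈ 0# → act S (E ⋆ h) ≋ (E 0 ·ₚ act S h +ₚ y ⋆ act S (shift² E ⋆ h))
    act-⋆-unfold E h E₁≈0 n = begin
      act S (E ⋆ h) n
        ≈⟨ act-unfold (E ⋆ h) n ⟩
      (E 0 * h 0) * onePS n + ((E ⋆ h) 1 * f₁ S n + (y ⋆ act S (shift² (E ⋆ h))) n)
        ≈⟨ +-cong refl (+-cong (*-cong (⋆-coeff₁ E h E₁≈0) refl) tail) ⟩
      (E 0 * h 0) * onePS n + ((E 0 * h 1) * f₁ S n + (E 0 * (y ⋆ act S (shift² h)) n + rest))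
        ≈⟨ factor (E 0) (h 0) (onePS n) (h 1) (f₁ S n) _ rest ⟩
      E 0 * (h 0 * onePS n + (h 1 * f₁ S n + (y ⋆ act S (shift² h)) n)) + rest
        ≈⟨ +-cong (*-cong refl (act-unfold h n)) refl ⟨
      E 0 * act S h n + rest
        ∎
      where
      open import Algebra.Solver.Ring.NaturalCoefficients.Default commutativeSemiring
      rest : Carrier
      rest = (y ⋆ act S (shift² E ⋆ h)) n
      factor : ∀ a b c d e f r → (a * b) * c + ((a * d) * e + (a * f + r)) ≈ a * (b * c + (d * e + f)) + r
      factor = solve 7 (λ a b c d e f r → (a :* b) :* c :+ ((a :* d) :* e :+ (a :* f :+ r))
                                         := a :* (b :* c :+ (d :* e :+ f)) :+ r) refl
      tail : (y ⋆ act S (shift² (E ⋆ h))) n ≈ E 0 * (y ⋆ act S (shift² h)) n + rest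
      tail = begin
        (y ⋆ act S (shift² (E ⋆ h))) n
          ≈⟨ ⋆-congʳ y (≋-trans (apply-cong (entry S) (shift²-⋆ E h E₁≈0))
                                (apply-+ₚ (entry S) (E 0 ·ₚ shift² h) (shift² E ⋆ h))) n ⟩
        (y ⋆ (act S (E 0 ·ₚ shift² h) +ₚ act S (shift² E ⋆ h))) n
          ≈⟨ ⋆-distribˡ y (act S (E 0 ·ₚ shift² h)) (act S (shift² E ⋆ h)) n ⟩
        (y ⋆ act S (E 0 ·ₚ shift² h)) n + rest
          ≈⟨ +-cong (trans (⋆-congʳ y (apply-·ₚ (entry S) (E 0) (shift² h)) n)
                           (⋆-·ₚʳ (E 0) y (act S (shift² h)) n)) refl ⟩
        E 0 * (y ⋆ act S (shift² h)) n + rest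
          ∎

    act-⋆-act-unfold : ∀ E h → E 1 ≈ 0# →
                       (act S E ⋆ act S h) ≋ (E 0 ·ₚ act S h +ₚ (y ⋆ act S (shift² E)) ⋆ act S h)
    act-⋆-act-unfold E h E₁≈0 n = begin
      (act S E ⋆ act S h) n
        ≈⟨ ⋆-congˡ (act S h) (act-unfold-even E E₁≈0) n ⟩
      ((E 0 ·ₚ onePS +ₚ y ⋆ act S (shift² E)) ⋆ act S h) n
        ≈⟨ ⋆-distribʳ (E 0 ·ₚ onePS) (y ⋆ act S (shift² E)) (act S h) n ⟩
      ((E 0 ·ₚ onePS) ⋆ act S h) n + ((y ⋆ act S (shift² E)) ⋆ act S h) n
        ≈⟨ +-cong (trans (⋆-·ₚˡ (E 0) onePS (act S h) n) (*-cong refl (⋆-identityˡ (act S h) n))) refl ⟩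
      E 0 * act S h n + ((y ⋆ act S (shift² E)) ⋆ act S h) n
        ∎

    act-multiplicative : ∀ {E} h → Even E → act S (E ⋆ h) ≋ (act S E ⋆ act S h)
    act-multiplicative h E-even n = <-rec P step n E-even
      where
      P : ℕ → Set _
      P n = ∀ {E} → Even E → act S (E ⋆ h) n ≈ (act S E ⋆ act S h) n
      step : ∀ n → (∀ {m} → m < n → P m) → P n
      step n ih {E} E-even = begin
        act S (E ⋆ h) n
          ≈⟨ act-⋆-unfold E h E₁≈0 n ⟩
        E 0 * act S h n + (y ⋆ act S (shift² E ⋆ h)) n
          ≈⟨ +-cong refl (⋆-local y _ _ n (y-order 0 (s≤s z≤n)) (λ m<n → ih m<n shift²E-even)) ⟩
        E 0 * act S h n + (y ⋆ (act S (shift² E) ⋆ act S h)) n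
          ≈⟨ +-cong refl (⋆-assoc y (act S (shift² E)) (act S h) n) ⟨
        E 0 * act S h n + ((y ⋆ act S (shift² E)) ⋆ act S h) n
          ≈⟨ act-⋆-act-unfold E h E₁≈0 n ⟨
        (act S E ⋆ act S h) n
          ∎
        where
        E₁≈0 : E 1 ≈ 0#
        E₁≈0 = E-even 1 ≡.refl
        shift²E-even : Even (shift² E)
        shift²E-even m = E-even (suc (suc m))

  invPS-≋1 : ∀ {b} → b ≋ onePS → invPS b ≋ onePS
  invPS-≋1 {b} b≋1 n = geometric n refl (λ _ → refl)
    where
    -- The series e of invPS is local to its definition, so it is pinned down by its equations.
    geometric : ∀ {e} n → e 0 ≈ 0# → (∀ m → e (suc m) ≈ - (b 0 ⁻¹ * b (suc m))) →
                b 0 ⁻¹ * sumTo n (λ j → (e ^ₚ j) n) ≈ onePS n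
    geometric {e} n e₀≈0 e-suc =
      trans (*-cong (x≈1⇒x⁻¹≈1 (b≋1 0)) (sumTo-single n z≤n higher)) (*-identityˡ (onePS n))
      where
      e≈0 : ∀ m → e m ≈ 0#
      e≈0 zero    = e₀≈0
      e≈0 (suc m) = trans (e-suc m) (trans (-‿cong (y≈0⇒x*y≈0 (b≋1 (suc m)))) ε⁻¹≈ε)
      higher : ∀ {j} → j ≤ n → j ≢ 0 → (e ^ₚ j) n ≈ 0#
      higher {zero}  _ 0≢0 = ⊥-elim (0≢0 ≡.refl)
      higher {suc j} _ _   = sumTo-zero n (λ {i} _ → x≈0⇒x*y≈0 (e≈0 i))

  divPS-≋1 : ∀ a {b} → b ≋ onePS → divPS a b ≋ a
  divPS-≋1 a b≋1 = ≋-trans (⋆-congʳ a (invPS-≋1 b≋1)) (⋆-identityʳ a)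

  module _ (S T : Triple) (S∈H : InH S) (gT≋1 : g T ≋ onePS) where
    open Action S S∈H using (act-one)

    ⊙-g : g (S ⊙ T) ≋ onePS
    ⊙-g = ≋-trans (apply-cong (entry S) gT≋1) act-one

    ⊙-f₁ : f₁ (S ⊙ T) ≋ act S (f₁ T)
    ⊙-f₁ = ≋-trans (divPS-≋1 _ ⊙-g)
                   (apply-cong (entry S) (≋-trans (⋆-congˡ (f₁ T) gT≋1) (⋆-identityˡ (f₁ T))))

    ⊙-f₂ : f₂ (S ⊙ T) ≋ shiftPS (act S (xPS ⋆ f₂ T))
    ⊙-f₂ n = trans (divPS-≋1 _ ⊙-g (suc n)) (apply-cong (entry S) (⋆-congˡ (f₂ T) x⋆gT≋x) (suc n))
      where
      x⋆gT≋x : (xPS ⋆ g T) ≋ xPS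
      x⋆gT≋x = ≋-trans (⋆-congʳ xPS gT≋1) (⋆-identityʳ xPS)

  ⊙-closed : ∀ S T → InH S → InH T → InH (S ⊙ T)
  ⊙-closed S T S∈H T∈H@(_ , gT≋1) =
    (g₀≉0 , f₁₀≈0 , f₁₁≉0 , f₂₀≈0 , f₂₁≉0 , f₂-odd) , ⊙-g S T S∈H gT≋1
    where
    open Action S S∈H using (entry-preservesEven; act-leading≉0)
    module T = Action T T∈H
    f₁T-order : OrderAtLeast 1 (f₁ T)
    f₁T-order = VanishesOn-≋ T.col-1 (T.entry-lowerTriangular 1)
    act-f₁T-order : OrderAtLeast 1 (act S (f₁ T))
    act-f₁T-order = apply-vanishesOn (PreservesVanishingOn-< (entry S) 1) f₁T-order
    act-yT-order : OrderAtLeast 2 (act S T.y)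
    act-yT-order = apply-vanishesOn (PreservesVanishingOn-< (entry S) 2) T.y-order
    g₀≉0 : ¬ (g (S ⊙ T) 0 ≈ 0#)
    g₀≉0 g₀≈0 = 1≉0 (trans (sym (⊙-g S T S∈H gT≋1 0)) g₀≈0)
    f₁₀≈0 : f₁ (S ⊙ T) 0 ≈ 0#
    f₁₀≈0 = trans (⊙-f₁ S T S∈H gT≋1 0) (act-f₁T-order 0 (s≤s z≤n))
    f₁₁≉0 : ¬ (f₁ (S ⊙ T) 1 ≈ 0#)
    f₁₁≉0 f₁₁≈0 = act-leading≉0 f₁T-order T.f₁₁≉0 (trans (sym (⊙-f₁ S T S∈H gT≋1 1)) f₁₁≈0)
    f₂₀≈0 : f₂ (S ⊙ T) 0 ≈ 0#
    f₂₀≈0 = trans (⊙-f₂ S T S∈H gT≋1 0) (act-yT-order 1 (s≤s (s≤s z≤n)))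
    f₂₁≉0 : ¬ (f₂ (S ⊙ T) 1 ≈ 0#)
    f₂₁≉0 f₂₁≈0 = act-leading≉0 T.y-order (λ y₂≈0 → T.f₂₁≉0 (trans (sym (x⋆-suc (f₂ T) 1)) y₂≈0))
                                (trans (sym (⊙-f₂ S T S∈H gT≋1 1)) f₂₁≈0)
    f₂-odd : ∀ m → f₂ (S ⊙ T) (2 ℕ.* m) ≈ 0#
    f₂-odd m = trans (⊙-f₂ S T S∈H gT≋1 (2 ℕ.* m))
                     (apply-vanishesOn entry-preservesEven T.y-even (suc (2 ℕ.* m)) (Odd-suc-2* m))

  idS∈H : InH idS
  idS∈H = (1≉0 , refl , 1≉0 , refl , 1≉0 , x-odd) , λ _ → refl
    where
    x-odd : ∀ m → xPS (2 ℕ.* m) ≈ 0#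
    x-odd zero    = refl
    x-odd (suc m) = reflexive (≡.cong xPS (ℕP.*-suc 2 m))

  module Inverse (S : Triple) (S∈H : InH S) where
    open Action S S∈H

    private
      solve : ∀ b → Σ PS (λ h → act S h ≋ b)
      solve = apply-surjective entry-nonzeroDiagonal

    v₁ w : PS
    v₁ = proj₁ (solve (xPS ^ₚ 1))
    w  = proj₁ (solve (xPS ^ₚ 2))

    act-v₁ : act S v₁ ≋ (xPS ^ₚ 1)
    act-v₁ = proj₂ (solve (xPS ^ₚ 1))

    act-w : act S w ≋ (xPS ^ₚ 2)
    act-w = proj₂ (solve (xPS ^ₚ 2))

    S⁻¹ : Triple
    S⁻¹ = ⟨ onePS , v₁ , shiftPS w ⟩

    v₁-order : OrderAtLeast 1 v₁
    v₁-order = apply-vanishesOn⁻¹ entry-nonzeroDiagonal (PreservesVanishingOn-< (entry S) 1)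
                                  (VanishesOn-≋ (≋-sym act-v₁) (x^ₚ-order 1))

    w-order : OrderAtLeast 2 w
    w-order = apply-vanishesOn⁻¹ entry-nonzeroDiagonal (PreservesVanishingOn-< (entry S) 2)
                                 (VanishesOn-≋ (≋-sym act-w) (x^ₚ-order 2))

    w-even : Even w
    w-even = apply-vanishesOn⁻¹ entry-nonzeroDiagonal entry-preservesEven
                                (VanishesOn-≋ (≋-sym act-w) x^ₚ2-even)

    S⁻¹∈H : InH S⁻¹
    S⁻¹∈H = ( 1≉0
            , v₁-order 0 (s≤s z≤n)
            , act-leading≉0⁻¹ v₁-order (λ Sv₁≈0 → x^ₚ-diagonal≉0 1 (trans (sym (act-v₁ 1)) Sv₁≈0))
            , w-order 1 (s≤s (s≤s z≤n))
            , act-leading≉0⁻¹ w-order (λ Sw≈0 → x^ₚ-diagonal≉0 2 (trans (sym (act-w 2)) Sw≈0))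
            , (λ m → w-even (suc (2 ℕ.* m)) (Odd-suc-2* m)) )
          , (λ _ → refl)

    module S⁻¹ = Action S⁻¹ S⁻¹∈H

    S⁻¹-y≋w : S⁻¹.y ≋ w
    S⁻¹-y≋w = x⋆-shiftPS w (w-order 0 (s≤s z≤n))

    S⊙S⁻¹≈id : (S ⊙ S⁻¹) ≈S idS
    S⊙S⁻¹≈id = ⊙-g S S⁻¹ S∈H (λ _ → refl)
             , ≋-trans (⊙-f₁ S S⁻¹ S∈H (λ _ → refl)) (≋-trans act-v₁ x^ₚ1≋x)
             , ≋-trans (⊙-f₂ S S⁻¹ S∈H (λ _ → refl))
                       (λ n → trans (apply-cong (entry S) S⁻¹-y≋w (suc n))
                                    (trans (act-w (suc n)) (shiftPS-x^ₚ2 n)))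

    act-S⁻¹-columns : ∀ k → act S (S⁻¹.col k) ≋ (xPS ^ₚ k)
    act-S⁻¹-columns zero          = ≋-trans (apply-cong (entry S) S⁻¹.col-0) act-one
    act-S⁻¹-columns (suc zero)    = ≋-trans (apply-cong (entry S) S⁻¹.col-1) act-v₁
    act-S⁻¹-columns (suc (suc k)) =
      ≋-trans (apply-cong (entry S) (≋-trans (S⁻¹.col-suc-suc k) (⋆-congˡ (S⁻¹.col k) S⁻¹-y≋w)))
      (≋-trans (act-multiplicative (S⁻¹.col k) w-even)
      (≋-trans (⋆-cong act-w (act-S⁻¹-columns k))
               (≋-sym (^ₚ-+ xPS 2 k))))

    act-S∘S⁻¹ : ∀ h → act S (act S⁻¹ h) ≋ h
    act-S∘S⁻¹ = apply-inverseˡ (entry S) S⁻¹.entry-lowerTriangular act-S⁻¹-columns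

    act-S⁻¹∘S : ∀ h → act S⁻¹ (act S h) ≋ h
    act-S⁻¹∘S h = apply-injective entry-nonzeroDiagonal (act-S∘S⁻¹ (act S h))

    S⁻¹⊙S≈id : (S⁻¹ ⊙ S) ≈S idS
    S⁻¹⊙S≈id = ⊙-g S⁻¹ S S⁻¹∈H g≋1
             , ≋-trans (⊙-f₁ S⁻¹ S S⁻¹∈H g≋1)
                       (≋-trans (apply-cong (entry S⁻¹) f₁≋act-x)
                                (≋-trans (act-S⁻¹∘S (xPS ^ₚ 1)) x^ₚ1≋x))
             , ≋-trans (⊙-f₂ S⁻¹ S S⁻¹∈H g≋1)
                       (λ n → trans (apply-cong (entry S⁻¹) y≋act-x² (suc n))
                                    (trans (act-S⁻¹∘S (xPS ^ₚ 2) (suc n)) (shiftPS-x^ₚ2 n)))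
      where
      f₁≋act-x : f₁ S ≋ act S (xPS ^ₚ 1)
      f₁≋act-x = ≋-sym (≋-trans (act-x^ₚ 1) col-1)
      y≋act-x² : y ≋ act S (xPS ^ₚ 2)
      y≋act-x² = ≋-sym (≋-trans (act-x^ₚ 2)
                        (≋-trans (col-suc-suc 0) (≋-trans (⋆-congʳ y col-0) (⋆-identityʳ y))))

  isSubgroupH : IsSubgroupH
  isSubgroupH = idS∈H , ⊙-closed , inverse
    where
    inverse : ∀ S → InH S → Σ Triple (λ T → InH T × (S ⊙ T) ≈S idS × (T ⊙ S) ≈S idS)
    inverse S S∈H = S⁻¹ , S⁻¹∈H , S⊙S⁻¹≈id , S⁻¹⊙S≈id
      where open Inverse S S∈H

-- Characteristic 0 is not needed: only leading coefficients of f₁ and f₂ are ever inverted.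
mainTheorem7 : {c ℓ : Level} (F : Field c ℓ) → Sprugnoli.Char0 F → Sprugnoli.IsSubgroupH F
mainTheorem7 F _ = SubgroupH.isSubgroupH F
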